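{- Let $G$ be an interval graph and let $I$ and $J$ be two independent sets of $G$ of size $k\geq 2$ such that there exists a token-sliding reconfiguration sequence from $I$ to $J$. Let $w$ be the $\prec_l$-largest vertex among the second leftmost vertices of all independent sets in this sequence. Then the leftmost vertex of $I$ and the leftmost vertex of $J$ lie in the same connected component of $G^w$.
   Context: Each vertex $x$ of $G$ is represented by an interval with left extremity $l(x)$ and right extremity $r(x)$, all extremities pairwise distinct; vertices are adjacent iff their intervals intersect. $x\prec_l y$ means $l(x)<l(y)$. For a vertex $w$, $G^w$ is the subgraph induced by the vertices $x$ with $r(x)<l(w)$. The vertices of an independent set are totally ordered by their intervals; the leftmost and second leftmost vertices are the first and second in this order. A token-sliding reconfiguration sequence is a sequence of independent sets of the same size in which consecutive sets $A,B$ satisfy $A\setminus B=\{x\}$, $B\setminus A=\{y\}$ with $xy$ an edge. -}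

module Defs where

open import Data.Nat using (ℕ; _<_; _≤_)
open import Data.Fin using (Fin)
open import Data.Fin.Subset using (Subset; _∈_; _∉_; _─_; ⁅_⁆; ∣_∣)
open import Data.List using (List; []; _∷_)
open import Data.List.Membership.Propositional using () renaming (_∈_ to _∈ₗ_)
open import Data.Product using (Σ; ∃; ∃-syntax; _×_)
open import Relation.Binary.PropositionalEquality using (_≡_; _≢_)
open import Relation.Nullary using (¬_)

-- An interval graph on vertex set Fin n: vertex x is the interval [l x , r x],
-- all 2n extremities pairwise distinct.
record IntervalGraph : Set where
  field
    n      : ℕ
    l r    : Fin n → ℕ
    l<r    : ∀ x → l x < r x
    l-inj  : ∀ x y → l x ≡ l y → x ≡ y
    r-inj  : ∀ x y → r x ≡ r y → x ≡ y
    l≢r    : ∀ x y → l x ≢ r y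

module _ (G : IntervalGraph) where
  open IntervalGraph G

  Adj : Fin n → Fin n → Set
  Adj x y = x ≢ y × l x ≤ r y × l y ≤ r x

  Independent : Subset n → Set
  Independent S = ∀ x y → x ∈ S → y ∈ S → ¬ Adj x y

  Leftmost : Subset n → Fin n → Set
  Leftmost S x = x ∈ S × (∀ y → y ∈ S → y ≢ x → l x < l y)

  SecondLeftmost : Subset n → Fin n → Set
  SecondLeftmost S x =
    x ∈ S × (∃[ y ] (Leftmost S y × y ≢ x ×
      (∀ z → z ∈ S → z ≢ x → z ≢ y → l x < l z)))

  TSStep : Subset n → Subset n → Set
  TSStep A B = ∃[ x ] ∃[ y ] (A ─ B ≡ ⁅ x ⁆ × B ─ A ≡ ⁅ y ⁆ × Adj x y)

  -- TSSeq k A B σ : σ is a token-sliding reconfiguration sequence from A to B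
  -- (σ lists all the sets of the sequence, in order), consisting of
  -- independent sets of size k.
  data TSSeq (k : ℕ) : Subset n → Subset n → List (Subset n) → Set where
    done : ∀ {A} → Independent A → ∣ A ∣ ≡ k → TSSeq k A A (A ∷ [])
    step : ∀ {A B C σ} → Independent A → ∣ A ∣ ≡ k → TSStep A B →
           TSSeq k B C σ → TSSeq k A C (A ∷ σ)

  InGw : Fin n → Fin n → Set
  InGw w x = r x < l w

  data WalkGw (w : Fin n) : Fin n → Fin n → Set where
    here : ∀ {a} → InGw w a → WalkGw w a a
    next : ∀ {a b c} → InGw w a → Adj a b → WalkGw w b c → WalkGw w a c

  SameComponentGw : Fin n → Fin n → Fin n → Set
  SameComponentGw w a b = WalkGw w a b

-- In an independent set of an interval graph the leftmost interval ends before
-- the second leftmost one starts, so at every stage of the sequence the leftmost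
-- vertex lies in G^w.  A token slide either leaves the leftmost vertex in place
-- or moves it along an edge to the new leftmost vertex; following the leftmost
-- token through the sequence therefore gives a walk in G^w from the leftmost
-- vertex of I to that of J.
module Submission where

open import Defs
open import Data.Nat using (ℕ; _≤_; _<_; _≤?_)
open import Data.Nat.Properties
  using (≤-refl; ≤-trans; 1+n≰n; <⇒≤; <-≤-trans; ≤-<-trans; <-asym; ≰⇒>; ≤∧≢⇒<; <-cmp; ≤-reflexive)
open import Data.Fin using (Fin; zero; suc; _≟_)
open import Data.Fin.Subset
  using (Subset; ∣_∣; _─_; _-_; ⁅_⁆; Nonempty; outside; inside) renaming (_∈_ to _∈ₛ_; _∉_ to _∉ₛ_)
open import Data.Fin.Subset.Properties
  using (_∈?_; nonempty?; drop-there; x∈p∧x∉q⇒x∈p─q; p─q⊆p; x∈⁅x⁆; x∈⁅y⁆⇒x≡y; p⊆q⇒∣p∣≤∣q∣; ∣⁅x⁆∣≡1; x∈p∧x≢y⇒x∈p-y)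
open import Data.Vec using (_∷_) renaming (here to hereᵥ; there to thereᵥ)
open import Data.List using (List)
open import Data.List.Membership.Propositional using (_∈_)
open import Data.List.Relation.Unary.Any using (here; there)
open import Data.Product using (∃-syntax; _×_; _,_)
open import Data.Sum using (_⊎_; inj₁; inj₂)
open import Relation.Nullary using (yes; no; contradiction)
open import Relation.Binary using (tri<; tri≈; tri>)
open import Relation.Binary.PropositionalEquality using (_≡_; _≢_; refl; sym; subst; ≢-sym)

x∈p─q⇒x∉q : ∀ {n} {x : Fin n} (p q : Subset n) → x ∈ₛ p ─ q → x ∉ₛ q
x∈p─q⇒x∉q (_ ∷ p) (_ ∷ q) (thereᵥ x∈p─q) (thereᵥ x∈q) = x∈p─q⇒x∉q p q x∈p─q x∈q
x∈p─q⇒x∉q (_ ∷ p) (inside ∷ q) () hereᵥ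

module _ {n} {p q : Subset n} {x : Fin n} (p─q≡⁅x⁆ : p ─ q ≡ ⁅ x ⁆) where

  p─q≡⁅x⁆⇒x∈p─q : x ∈ₛ p ─ q
  p─q≡⁅x⁆⇒x∈p─q = subst (x ∈ₛ_) (sym p─q≡⁅x⁆) (x∈⁅x⁆ x)

  p─q≡⁅x⁆⇒x∈p : x ∈ₛ p
  p─q≡⁅x⁆⇒x∈p = p─q⊆p p q p─q≡⁅x⁆⇒x∈p─q

  p─q≡⁅x⁆⇒x∉q : x ∉ₛ q
  p─q≡⁅x⁆⇒x∉q = x∈p─q⇒x∉q p q p─q≡⁅x⁆⇒x∈p─q

  p─q≡⁅x⁆⇒p-x⊆q : ∀ {z} → z ∈ₛ p → z ≢ x → z ∈ₛ q
  p─q≡⁅x⁆⇒p-x⊆q {z} z∈p z≢x with z ∈? q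
  ... | yes z∈q = z∈q
  ... | no  z∉q = contradiction (x∈⁅y⁆⇒x≡y x (subst (z ∈ₛ_) p─q≡⁅x⁆ (x∈p∧x∉q⇒x∈p─q z∈p z∉q))) z≢x

∃-minimum : ∀ {n} (f : Fin n → ℕ) (p : Subset n) → Nonempty p →
  ∃[ x ] (x ∈ₛ p × (∀ y → y ∈ₛ p → f x ≤ f y))
∃-minimum f (outside ∷ p) (suc x , x∈p) with ∃-minimum (λ i → f (suc i)) p (x , drop-there x∈p)
... | m , m∈p , m-min = suc m , thereᵥ m∈p , λ { (suc y) (thereᵥ y∈p) → m-min y y∈p }
∃-minimum f (inside ∷ p) _ with nonempty? p
... | no  p-empty = zero , hereᵥ , λ
  { zero hereᵥ → ≤-refl ; (suc y) (thereᵥ y∈p) → contradiction (y , y∈p) p-empty }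
... | yes p-nonempty with ∃-minimum (λ i → f (suc i)) p p-nonempty
...   | m , m∈p , m-min with f zero ≤? f (suc m)
...     | yes f0≤fm = zero , hereᵥ , λ
  { zero hereᵥ → ≤-refl ; (suc y) (thereᵥ y∈p) → ≤-trans f0≤fm (m-min y y∈p) }
...     | no  f0≰fm = suc m , thereᵥ m∈p , λ
  { zero hereᵥ → <⇒≤ (≰⇒> f0≰fm) ; (suc y) (thereᵥ y∈p) → m-min y y∈p }

module _ (G : IntervalGraph) where
  open IntervalGraph G

  l-injective : ∀ {x y} → x ≢ y → l x ≢ l y
  l-injective x≢y lx≡ly = x≢y (l-inj _ _ lx≡ly)

  independent-l<l⇒r<l : ∀ {S x y} → Independent G S → x ∈ₛ S → y ∈ₛ S → x ≢ y →
    l x < l y → r x < l y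
  independent-l<l⇒r<l {y = y} S-ind x∈S y∈S x≢y lx<ly =
    ≰⇒> λ ly≤rx → S-ind _ _ x∈S y∈S (x≢y , ≤-trans (<⇒≤ lx<ly) (<⇒≤ (l<r y)) , ly≤rx)

  leftmost-unique : ∀ {S a b} → Leftmost G S a → Leftmost G S b → a ≡ b
  leftmost-unique {a = a} {b} (a∈S , a-min) (b∈S , b-min) with a ≟ b
  ... | yes a≡b = a≡b
  ... | no  a≢b = contradiction (b-min a a∈S a≢b) (<-asym (a-min b b∈S (≢-sym a≢b)))

  leftmost-ends-first : ∀ {S f y} → Independent G S → Leftmost G S f → y ∈ₛ S → y ≢ f →
    r f < l y
  leftmost-ends-first S-ind (f∈S , f-min) y∈S y≢f =
    independent-l<l⇒r<l S-ind f∈S y∈S (≢-sym y≢f) (f-min _ y∈S y≢f)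

  ∃-secondLeftmost : ∀ {S f} → 2 ≤ ∣ S ∣ → Leftmost G S f → ∃[ s ] SecondLeftmost G S s
  ∃-secondLeftmost {S} {f} 2≤∣S∣ f-leftmost@(f∈S , _) with nonempty? (S - f)
  ... | no  S-f-empty = contradiction (≤-trans 2≤∣S∣ ∣S∣≤1) 1+n≰n
    where
    S⊆⁅f⁆ : ∀ {z} → z ∈ₛ S → z ∈ₛ ⁅ f ⁆
    S⊆⁅f⁆ {z} z∈S with z ≟ f
    ... | yes refl = x∈⁅x⁆ f
    ... | no  z≢f  = contradiction (z , x∈p∧x≢y⇒x∈p-y z∈S z≢f) S-f-empty
    ∣S∣≤1 : ∣ S ∣ ≤ 1
    ∣S∣≤1 = ≤-trans (p⊆q⇒∣p∣≤∣q∣ S⊆⁅f⁆) (≤-reflexive (∣⁅x⁆∣≡1 f))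
  ... | yes S-f-nonempty with ∃-minimum l (S - f) S-f-nonempty
  ...   | s , s∈S-f , s-min = s , s∈S , f , f-leftmost , f≢s , s-second
    where
    s∈S : s ∈ₛ S
    s∈S = p─q⊆p S ⁅ f ⁆ s∈S-f
    f≢s : f ≢ s
    f≢s refl = x∈p─q⇒x∉q S ⁅ f ⁆ s∈S-f (x∈⁅x⁆ f)
    s-second : ∀ z → z ∈ₛ S → z ≢ s → z ≢ f → l s < l z
    s-second z z∈S z≢s z≢f = ≤∧≢⇒< (s-min z (x∈p∧x≢y⇒x∈p-y z∈S z≢f)) (l-injective (≢-sym z≢s))

  leftmost∈Gw : ∀ {S f} w → Independent G S → 2 ≤ ∣ S ∣ → Leftmost G S f →
    (∀ v → SecondLeftmost G S v → l v ≤ l w) → InGw G w f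
  leftmost∈Gw w S-ind 2≤∣S∣ f-leftmost below-w
    with ∃-secondLeftmost 2≤∣S∣ f-leftmost
  ... | s , s-second@(s∈S , f′ , f′-leftmost , f′≢s , _)
    with leftmost-unique f-leftmost f′-leftmost
  ... | refl = <-≤-trans (leftmost-ends-first S-ind f-leftmost s∈S (≢-sym f′≢s)) (below-w s s-second)

  slide-leftmost : ∀ {A B a} → Independent G A → Independent G B → TSStep G A B →
    Leftmost G A a → ∃[ b ] (Leftmost G B b × (a ≡ b ⊎ Adj G a b))
  slide-leftmost {A} {B} {a} A-ind B-ind (x , y , A─B≡⁅x⁆ , B─A≡⁅y⁆ , x~y@(_ , lx≤ry , ly≤rx))
                 a-leftmost@(a∈A , a-min)
    with a ≟ x
  ... | yes refl = y , (y∈B , y-min) , inj₂ x~y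
    where
    y∈B : y ∈ₛ B
    y∈B = p─q≡⁅x⁆⇒x∈p B─A≡⁅y⁆
    y-min : ∀ z → z ∈ₛ B → z ≢ y → l y < l z
    y-min z z∈B z≢y = ≤-<-trans ly≤rx (leftmost-ends-first A-ind a-leftmost z∈A z≢a)
      where
      z∈A : z ∈ₛ A
      z∈A = p─q≡⁅x⁆⇒p-x⊆q B─A≡⁅y⁆ z∈B z≢y
      z≢a : z ≢ a
      z≢a refl = p─q≡⁅x⁆⇒x∉q A─B≡⁅x⁆ z∈B
  ... | no  a≢x = a , (a∈B , a-min′) , inj₁ refl
    where
    a∈B : a ∈ₛ B
    a∈B = p─q≡⁅x⁆⇒p-x⊆q A─B≡⁅x⁆ a∈A a≢x
    -- If the new token y started left of a, it would also end left of a, yet it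
    -- reaches x, which starts right of a.
    a-min′ : ∀ z → z ∈ₛ B → z ≢ a → l a < l z
    a-min′ z z∈B z≢a with z ≟ y
    ... | no  z≢y = a-min z (p─q≡⁅x⁆⇒p-x⊆q B─A≡⁅y⁆ z∈B z≢y) z≢a
    ... | yes refl with <-cmp (l a) (l z)
    ...   | tri< la<lz _ _ = la<lz
    ...   | tri≈ _ la≡lz _ = contradiction (sym (l-inj _ _ la≡lz)) z≢a
    ...   | tri> _ _ lz<la = contradiction
              (independent-l<l⇒r<l B-ind z∈B a∈B z≢a lz<la)
              (<-asym (<-≤-trans (a-min x (p─q≡⁅x⁆⇒x∈p A─B≡⁅x⁆) (≢-sym a≢x)) lx≤ry))

  TSSeq-head-independent : ∀ {k A C σ} → TSSeq G k A C σ → Independent G A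
  TSSeq-head-independent (done A-ind _)     = A-ind
  TSSeq-head-independent (step A-ind _ _ _) = A-ind

  TSSeq-member : ∀ {k A C σ S} → TSSeq G k A C σ → S ∈ σ → Independent G S × ∣ S ∣ ≡ k
  TSSeq-member (done S-ind ∣S∣≡k)     (here refl) = S-ind , ∣S∣≡k
  TSSeq-member (step S-ind ∣S∣≡k _ _) (here refl) = S-ind , ∣S∣≡k
  TSSeq-member (step _ _ _ seq)       (there S∈σ) = TSSeq-member seq S∈σ

  leftmosts-connected : ∀ {k A C σ a c} w → TSSeq G k A C σ →
    (∀ S → S ∈ σ → ∀ f → Leftmost G S f → InGw G w f) →
    Leftmost G A a → Leftmost G C c → WalkGw G w a c
  leftmosts-connected w (done _ _) leftmosts∈Gw a-leftmost c-leftmost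
    with leftmost-unique a-leftmost c-leftmost
  ... | refl = here (leftmosts∈Gw _ (here refl) _ a-leftmost)
  leftmosts-connected {a = a} {c} w (step {B = B} A-ind _ A→B seq) leftmosts∈Gw a-leftmost c-leftmost =
    extend (slide-leftmost A-ind (TSSeq-head-independent seq) A→B a-leftmost)
    where
    onward : ∀ {b} → Leftmost G B b → WalkGw G w b c
    onward b-leftmost = leftmosts-connected w seq (λ S S∈σ → leftmosts∈Gw S (there S∈σ)) b-leftmost c-leftmost
    extend : ∃[ b ] (Leftmost G B b × (a ≡ b ⊎ Adj G a b)) → WalkGw G w a c
    extend (b , b-leftmost , inj₁ refl) = onward b-leftmost
    extend (b , b-leftmost , inj₂ a~b)  = next (leftmosts∈Gw _ (here refl) a a-leftmost) a~b (onward b-leftmost)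

lemma13 : (G : IntervalGraph) → (k : ℕ) → 2 ≤ k →
    (I J : Subset (IntervalGraph.n G)) → (σ : List (Subset (IntervalGraph.n G))) →
    TSSeq G k I J σ →
    (w : Fin (IntervalGraph.n G)) →
    (∃[ S ] (S ∈ σ × SecondLeftmost G S w)) →
    (∀ S v → S ∈ σ → SecondLeftmost G S v → IntervalGraph.l G v ≤ IntervalGraph.l G w) →
    (a b : Fin (IntervalGraph.n G)) → Leftmost G I a → Leftmost G J b →
    SameComponentGw G w a b
lemma13 G k 2≤k I J σ seq w _ second-leftmosts-below-w a b a-leftmost b-leftmost =
  leftmosts-connected G w seq leftmosts∈Gw a-leftmost b-leftmost
  where
  leftmosts∈Gw : ∀ S → S ∈ σ → ∀ f → Leftmost G S f → InGw G w f
  leftmosts∈Gw S S∈σ f f-leftmost with TSSeq-member G seq S∈σ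
  ... | S-ind , refl =
    leftmost∈Gw G w S-ind 2≤k f-leftmost (λ v → second-leftmosts-below-w S v S∈σ)
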